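{- Let $K \geq 2$ and $p \geq 1$ be integers. Let $\sigma \in S_n$ with $\sigma \notin \mathcal{C}(K,p)$ and $n > (Kp+2)^2-2$, such that every strict pattern $\tau$ of $\sigma$ (pattern with $|\tau|<n$) belongs to $\mathcal{C}(K,p)$. Then there is $i$ such that $\sigma = I\, i\, (i+1) \ldots (i+Kp)\, J$, where $I$ is a permutation of $[1..i-1]$ and $J$ is a permutation of $[i+Kp+1..n]$ (either of $I$, $J$ may be empty).
   Context: A permutation $\pi \in S_k$ is a pattern of $\sigma \in S_n$ if $\sigma$ has a subsequence order-isomorphic to $\pi$. A duplication-loss step of width $k$ applied to a permutation $\pi$ chooses a contiguous fragment of $k$ consecutive positions and a subset $S$ of its entries, and replaces the fragment by the entries of $S$ in their original relative order followed by the remaining entries of the fragment in their original relative order. $\mathcal{C}(K,p)$ is the class of all permutations (of any size $n$) obtained from the identity $12\ldots n$ after $p$ duplication-loss steps each of width at most $K$. Juxtaposition denotes concatenation of words. -}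

module Defs where

open import Data.Nat using (ℕ; zero; suc; _+_; _*_; _∸_; _^_; _<_; _≤_)
open import Data.Bool using (Bool; true; false)
open import Data.List using (List; []; _∷_; _++_; map; upTo; length)
open import Data.List.Relation.Binary.Permutation.Propositional using (_↭_)
open import Data.List.Relation.Binary.Sublist.Propositional using (_⊆_)
open import Data.List.Relation.Binary.Pointwise using (Pointwise)
open import Data.Product using (Σ; _×_; ∃; ∃-syntax)
open import Function.Bundles using (_⇔_)
open import Relation.Binary.PropositionalEquality using (_≡_)

idPerm : ℕ → List ℕ
idPerm n = map suc (upTo n)

IsPerm : ℕ → List ℕ → Set
IsPerm n σ = σ ↭ idPerm n

selected : List Bool → List ℕ → List ℕ
selected [] _ = []
selected (_ ∷ _) [] = []
selected (true ∷ m) (x ∷ xs) = x ∷ selected m xs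
selected (false ∷ m) (x ∷ xs) = selected m xs

unselected : List Bool → List ℕ → List ℕ
unselected [] _ = []
unselected (_ ∷ _) [] = []
unselected (true ∷ m) (x ∷ xs) = unselected m xs
unselected (false ∷ m) (x ∷ xs) = x ∷ unselected m xs

DLStep : ℕ → List ℕ → List ℕ → Set
DLStep K π π' =
  Σ (List ℕ) λ pre → Σ (List ℕ) λ frag → Σ (List ℕ) λ suf → Σ (List Bool) λ mask →
    (π ≡ pre ++ frag ++ suf) × (length frag ≤ K) × (length mask ≡ length frag) ×
    (π' ≡ pre ++ selected mask frag ++ unselected mask frag ++ suf)

DLSteps : ℕ → ℕ → List ℕ → List ℕ → Set
DLSteps K zero π π' = π ≡ π'
DLSteps K (suc p) π π' = Σ (List ℕ) λ ρ → DLStep K π ρ × DLSteps K p ρ π'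

InC : ℕ → ℕ → List ℕ → Set
InC K p σ = ∃[ n ] DLSteps K p (idPerm n) σ

-- order isomorphism of two words (all pairs of positions compare the same way)
data OrderIso : List ℕ → List ℕ → Set where
  []  : OrderIso [] []
  _∷_ : ∀ {x y a b} →
        Pointwise (λ x' y' → ((x < x') ⇔ (y < y')) × ((x' < x) ⇔ (y' < y))) a b →
        OrderIso a b → OrderIso (x ∷ a) (y ∷ b)

IsPattern : List ℕ → List ℕ → Set
IsPattern τ σ = Σ (List ℕ) λ s → (s ⊆ σ) × OrderIso τ s

-- Call v a cut of a word if every entry before v is smaller and every entry after v is larger.
-- A duplication-loss step only rearranges the entries of its fragment, so every cut outside the
-- fragment survives it; hence all but at most Kp values of a member of C(K,p) are cuts.  Deleting
-- an entry c of σ and renumbering gives a strict pattern, which lies in C(K,p), and the cuts of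
-- the pattern are cuts of σ with c removed.  Deleting the first and the last entry of σ thus
-- exhibits a cut v of σ among the middle entries, and deleting v shows that all values of σ but at
-- most Kp are cuts.  Splitting 1, …, (Kp+1)² into Kp+1 blocks of Kp+1 consecutive values, one block
-- i, …, i+Kp contains only cuts, and consecutive values that are all cuts of a permutation stand
-- next to each other, in increasing order, at their own positions.

module Submission where

open import Defs
open import Data.Nat using (ℕ; zero; suc; pred; _+_; _*_; _∸_; _^_; _<_; _≤_; z≤n; s≤s; _<?_)
open import Data.Nat.Properties
open import Data.Nat.Solver using (module +-*-Solver)
open import Data.Bool using (true; false)
open import Data.Fin using (toℕ)
import Data.Fin.Properties as Finₚ
open import Data.List using (List; []; _∷_; _++_; [_]; _∷ʳ_; map; upTo; applyUpTo; length; lookup; initLast; _∷ʳ′_)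
open import Data.List.Properties using (length-++; length-map; length-upTo; map-upTo; map-∘; map-cong; ++-assoc)
open import Data.List.Relation.Unary.All as All using (All; []; _∷_)
import Data.List.Relation.Unary.All.Properties as Allₚ
open import Data.List.Relation.Unary.Any as Any using (Any; here; there; index)
open import Data.List.Relation.Unary.Any.Properties using (lookup-index)
open import Data.List.Relation.Unary.AllPairs as AllPairs using ([]; _∷_)
open import Data.List.Relation.Unary.Unique.Propositional using (Unique)
import Data.List.Relation.Unary.Unique.Propositional.Properties as Uniqueₚ
open import Data.List.Membership.Propositional using (_∈_; _∉_; find; lose)
open import Data.List.Membership.Propositional.Properties using (∈-map⁺; ∈-map⁻; ∈-upTo⁺; ∈-upTo⁻; ∈-++⁺ˡ; ∈-++⁺ʳ; ∈-++⁻; ∈-∃++)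
open import Data.List.Membership.DecPropositional _≟_ using (_∈?_)
open import Data.List.Membership.Propositional.Properties.WithK using (unique∧set⇒bag)
open import Data.List.Relation.Binary.BagAndSetEquality using (∼bag⇒↭)
open import Data.List.Relation.Binary.Subset.Propositional using (_⊆_)
import Data.List.Relation.Binary.Subset.Propositional.Properties as Subsetₚ
import Data.List.Relation.Binary.Sublist.Propositional as Sublist
import Data.List.Relation.Binary.Sublist.Heterogeneous.Properties as Sublistₚ
open import Data.List.Relation.Binary.Pointwise using (Pointwise; []; _∷_)
open import Data.List.Relation.Binary.Permutation.Propositional using (_↭_; ↭-sym; ↭-trans; ↭⇒↭ₛ)
open import Data.List.Relation.Binary.Permutation.Propositional.Properties using (∈-resp-↭; ↭-length; ↭-empty-inv; shift; drop-∷)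
import Data.List.Relation.Binary.Permutation.Setoid.Properties as Permutationₛ
import Data.Product as Product
open import Data.Product using (Σ; _×_; ∃₂; ∃-syntax; _,_; proj₁; proj₂)
open import Data.Sum using (_⊎_; inj₁; inj₂; [_,_]′)
open import Data.Empty using (⊥; ⊥-elim)
open import Function using (_∘_)
open import Function.Bundles using (mk⇔)
open import Relation.Binary.Definitions using (tri<; tri≈; tri>)
open import Relation.Nullary using (¬_; yes; no; ¬?; contradiction)
open import Relation.Nullary.Decidable using (decidable-stable)
open import Relation.Binary.PropositionalEquality using (_≡_; _≢_; refl; sym; trans; cong; cong₂; subst; subst₂; setoid; module ≡-Reasoning)

range : ℕ → ℕ → List ℕ
range a m = map (a +_) (upTo m)

length-range : ∀ a m → length (range a m) ≡ m
length-range a m = trans (length-map (a +_) (upTo m)) (length-upTo m)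

range-suc : ∀ a m → range a (suc m) ≡ a ∷ range (suc a) m
range-suc a m = cong₂ _∷_ (+-identityʳ a) (begin
  map (a +_) (applyUpTo suc m)    ≡⟨ cong (map (a +_)) (map-upTo suc m) ⟨
  map (a +_) (map suc (upTo m))   ≡⟨ map-∘ (upTo m) ⟨
  map (λ t → a + suc t) (upTo m)  ≡⟨ map-cong (+-suc a) (upTo m) ⟩
  range (suc a) m                 ∎)
  where open ≡-Reasoning

∈-range-suc : ∀ {a m v} → v ∈ a ∷ range (suc a) m → v ∈ range a (suc m)
∈-range-suc {a} {m} {v} = subst (v ∈_) (sym (range-suc a m))

∈-range⁻ : ∀ {a m x} → x ∈ range a m → a ≤ x × x < a + m
∈-range⁻ {a} x∈ with t , t∈ , refl ← ∈-map⁻ (a +_) x∈ = m≤m+n a t , +-monoʳ-< a (∈-upTo⁻ t∈)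

∈-range⁺ : ∀ {a m x} → a ≤ x → x < a + m → x ∈ range a m
∈-range⁺ {a} {m} a≤x x<a+m with t , refl ← m≤n⇒∃[o]m+o≡n a≤x =
  ∈-map⁺ (a +_) (∈-upTo⁺ (+-cancelˡ-< a t m x<a+m))

range-⊆ : ∀ {a m m′} → m ≤ m′ → range a m ⊆ range a m′
range-⊆ {a} m≤m′ x∈ with a≤x , x< ← ∈-range⁻ x∈ = ∈-range⁺ a≤x (<-≤-trans x< (+-monoʳ-≤ a m≤m′))

∈-range-first : ∀ a m → a ∈ range a (m + 1)
∈-range-first a m = ∈-range⁺ ≤-refl (m<m+n a (m≤n+m 1 m))

∈-range-last : ∀ a m → a + m ∈ range a (m + 1)
∈-range-last a m = ∈-range⁺ (m≤m+n a m) (+-monoʳ-< a (m<m+n m (s≤s z≤n)))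

↭range-length : ∀ {xs a m} → xs ↭ range a m → length xs ≡ m
↭range-length {a = a} {m} xs↭ = trans (↭-length xs↭) (length-range a m)

range-unique : ∀ a m → Unique (range a m)
range-unique a m = Uniqueₚ.map⁺ (λ {x} {y} → +-cancelˡ-≡ a x y) (Uniqueₚ.upTo⁺ m)

Unique-resp-↭ : ∀ {xs ys : List ℕ} → xs ↭ ys → Unique xs → Unique ys
Unique-resp-↭ xs↭ys = Permutationₛ.Unique-resp-↭ (setoid ℕ) (↭⇒↭ₛ xs↭ys)

Unique-++⁻ : ∀ (xs : List ℕ) {ys} → Unique (xs ++ ys) → Unique xs × Unique ys
Unique-++⁻ []       u          = [] , u
Unique-++⁻ (x ∷ xs) (x∉ ∷ u) with uxs , uys ← Unique-++⁻ xs u = (Allₚ.++⁻ˡ xs x∉ ∷ uxs) , uys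

unique⇒length≤ : ∀ {xs ys : List ℕ} → Unique xs → All (_∈ ys) xs → length xs ≤ length ys
unique⇒length≤ {[]}     _            _               = z≤n
unique⇒length≤ {x ∷ xs} (x≢xs ∷ uxs) (x∈ys ∷ xs⊆ys) with ys₁ , ys₂ , refl ← ∈-∃++ x∈ys =
  ≤-trans (s≤s (unique⇒length≤ uxs (All.tabulate λ z∈xs → remove (All.lookup x≢xs z∈xs) (All.lookup xs⊆ys z∈xs))))
          (≤-reflexive (sym (↭-length (shift x ys₁ ys₂))))
  where
  remove : ∀ {z} → x ≢ z → z ∈ ys₁ ++ [ x ] ++ ys₂ → z ∈ ys₁ ++ ys₂
  remove x≢z z∈ with ∈-resp-↭ (shift x ys₁ ys₂) z∈
  ... | here z≡x = contradiction (sym z≡x) x≢z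
  ... | there z∈′ = z∈′

unique-⊆⇒↭ : ∀ {xs ys : List ℕ} → Unique xs → Unique ys → All (_∈ ys) xs → length ys ≤ length xs → xs ↭ ys
unique-⊆⇒↭ {xs} {ys} uxs uys xs⊆ys |ys|≤|xs| = ∼bag⇒↭ (unique∧set⇒bag uxs uys (mk⇔ (All.lookup xs⊆ys) ys⊆xs))
  where
  ys⊆xs : ∀ {y} → y ∈ ys → y ∈ xs
  ys⊆xs {y} y∈ys with y ∈? xs
  ... | yes y∈xs = y∈xs
  ... | no  y∉xs = contradiction |ys|≤|xs|
                     (<⇒≱ (unique⇒length≤ (Allₚ.¬Any⇒All¬ xs y∉xs ∷ uxs) (y∈ys ∷ xs⊆ys)))

∃∉-of-longer : ∀ {xs ys : List ℕ} → Unique xs → length ys < length xs → ∃[ x ] x ∈ xs × x ∉ ys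
∃∉-of-longer {xs} {ys} uxs |ys|<|xs| with All.all? (_∈? ys) xs
... | yes xs⊆ys = contradiction (unique⇒length≤ uxs xs⊆ys) (<⇒≱ |ys|<|xs|)
... | no  xs⊈ys = find (Allₚ.¬All⇒Any¬ (_∈? ys) xs xs⊈ys)

≤-tight-+ : ∀ {p q m k} → p ≤ m → q ≤ k → p + q ≡ m + k → m ≤ p × k ≤ q
≤-tight-+ p≤m q≤k eq =
  ≮⇒≥ (λ p<m → <-irrefl eq (+-mono-<-≤ p<m q≤k)) , ≮⇒≥ (λ q<k → <-irrefl eq (+-mono-≤-< p≤m q<k))

↭range-split : ∀ {xs ys : List ℕ} a m k → xs ++ ys ↭ range a (m + k) →
  All (_< a + m) xs → All (a + m ≤_) ys → xs ↭ range a m × ys ↭ range (a + m) k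
↭range-split {xs} {ys} a m k xs++ys↭ xs< ys≥ =
  unique-⊆⇒↭ uxs (range-unique a m) xs⊆ (subst (_≤ length xs) (sym (length-range a m)) (proj₁ tight)) ,
  unique-⊆⇒↭ uys (range-unique (a + m) k) ys⊆ (subst (_≤ length ys) (sym (length-range (a + m) k)) (proj₂ tight))
  where
  unique = Unique-++⁻ xs (Unique-resp-↭ (↭-sym xs++ys↭) (range-unique a (m + k)))
  uxs = proj₁ unique
  uys = proj₂ unique
  bounds : ∀ {z} → z ∈ xs ++ ys → a ≤ z × z < a + (m + k)
  bounds z∈ = ∈-range⁻ (∈-resp-↭ xs++ys↭ z∈)
  xs⊆ : All (_∈ range a m) xs
  xs⊆ = All.tabulate λ z∈ → ∈-range⁺ (proj₁ (bounds (∈-++⁺ˡ z∈))) (All.lookup xs< z∈)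
  ys⊆ : All (_∈ range (a + m) k) ys
  ys⊆ = All.tabulate λ {z} z∈ →
    ∈-range⁺ (All.lookup ys≥ z∈) (subst (z <_) (sym (+-assoc a m k)) (proj₂ (bounds (∈-++⁺ʳ xs z∈))))
  total : length xs + length ys ≡ m + k
  total = trans (sym (length-++ xs)) (trans (↭-length xs++ys↭) (length-range a (m + k)))
  tight : m ≤ length xs × k ≤ length ys
  tight = ≤-tight-+ (subst (length xs ≤_) (length-range a m) (unique⇒length≤ uxs xs⊆))
                    (subst (length ys ≤_) (length-range (a + m) k) (unique⇒length≤ uys ys⊆)) total

-- Cuts

data Cut (v : ℕ) : List ℕ → Set where
  here  : ∀ {xs} → All (v <_) xs → Cut v (v ∷ xs)
  there : ∀ {x xs} → x < v → Cut v xs → Cut v (x ∷ xs)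

cut⇒∈ : ∀ {v xs} → Cut v xs → v ∈ xs
cut⇒∈ (here _)    = here refl
cut⇒∈ (there _ c) = there (cut⇒∈ c)

cut⇒++ : ∀ {v xs} → Cut v xs → ∃₂ λ L R → xs ≡ L ++ v ∷ R × All (_< v) L × All (v <_) R
cut⇒++ (here {xs} v<xs) = [] , xs , refl , [] , v<xs
cut⇒++ (there {x} x<v c) with L , R , refl , L<v , v<R ← cut⇒++ c = x ∷ L , R , refl , x<v ∷ L<v , v<R

All-<⇒∉ : ∀ {v xs} → All (_< v) xs → v ∉ xs
All-<⇒∉ xs<v v∈xs = <-irrefl refl (All.lookup xs<v v∈xs)

cut-∷⇒< : ∀ {v x xs} → x ≢ v → Cut v (x ∷ xs) → x < v
cut-∷⇒< x≢v (here _)      = contradiction refl x≢v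
cut-∷⇒< x≢v (there x<v _) = x<v

cut-∷⁻ : ∀ {v x xs} → x < v → Cut v (x ∷ xs) → Cut v xs
cut-∷⁻ v<v (here _)    = contradiction v<v (<-irrefl refl)
cut-∷⁻ _   (there _ c) = c

cut-head : ∀ {v x xs} → Cut v (x ∷ xs) → v ≤ x → v ≡ x
cut-head (here _)      _   = refl
cut-head (there x<v _) v≤x = contradiction v≤x (<⇒≱ x<v)

cut-++⁺ : ∀ {v} xs {ys} → All (_< v) xs → Cut v ys → Cut v (xs ++ ys)
cut-++⁺ []       []            c = c
cut-++⁺ (x ∷ xs) (x<v ∷ xs<v) c = there x<v (cut-++⁺ xs xs<v c)

cut-++⁻ : ∀ {v} xs {ys} → v ∉ xs → Cut v (xs ++ ys) → All (_< v) xs × Cut v ys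
cut-++⁻ []       _   c             = [] , c
cut-++⁻ (x ∷ xs) v∉  (here _)      = contradiction (here refl) v∉
cut-++⁻ (x ∷ xs) v∉  (there x<v c) with xs<v , c′ ← cut-++⁻ xs (v∉ ∘ there) c = x<v ∷ xs<v , c′

cut-++ˡ : ∀ {v} xs {ys} → v ∈ xs → Cut v (xs ++ ys) → Cut v xs
cut-++ˡ (x ∷ xs) _           (here v<)    = here (Allₚ.++⁻ˡ xs v<)
cut-++ˡ (x ∷ xs) (here refl) (there v<v _) = contradiction v<v (<-irrefl refl)
cut-++ˡ (x ∷ xs) (there v∈)  (there x<v c) = there x<v (cut-++ˡ xs v∈ c)

cut-insert : ∀ {v e} L {R} → All (_< v) L → All (v <_) R → Cut e (L ++ R) → Cut e (L ++ v ∷ R)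
cut-insert []      _           v<R c              = there (All.lookup v<R (cut⇒∈ c)) c
cut-insert (x ∷ L) (x<v ∷ L<v) v<R (here x<L++R) =
  here (Allₚ.++⁺ (Allₚ.++⁻ˡ L x<L++R) (x<v ∷ Allₚ.++⁻ʳ L x<L++R))
cut-insert (x ∷ L) (_ ∷ L<v)   v<R (there x<e c)  = there x<e (cut-insert L L<v v<R c)

All-replace : ∀ {P : ℕ → Set} pre {frag frag′ suf} → frag′ ⊆ frag →
  All P (pre ++ frag ++ suf) → All P (pre ++ frag′ ++ suf)
All-replace pre {frag} frag′⊆frag P-all
  with P-pre , P-rest ← Allₚ.++⁻ pre P-all
  with P-frag , P-suf ← Allₚ.++⁻ frag P-rest =
  Allₚ.++⁺ P-pre (Allₚ.++⁺ (Subsetₚ.All-resp-⊇ frag′⊆frag P-frag) P-suf)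

cut-replace : ∀ {v} pre {frag frag′ suf} → frag′ ⊆ frag → v ∉ frag →
  Cut v (pre ++ frag ++ suf) → Cut v (pre ++ frag′ ++ suf)
cut-replace []        {frag} frag′⊆frag v∉ c with frag<v , c′ ← cut-++⁻ frag v∉ c =
  cut-++⁺ _ (Subsetₚ.All-resp-⊇ frag′⊆frag frag<v) c′
cut-replace (x ∷ pre) frag′⊆frag v∉ (here x<)    = here (All-replace pre frag′⊆frag x<)
cut-replace (x ∷ pre) frag′⊆frag v∉ (there x<v c) = there x<v (cut-replace pre frag′⊆frag v∉ c)

range-cuts : ∀ a m {v} → v ∈ range a m → Cut v (range a m)
range-cuts a zero    ()
range-cuts a (suc m) v∈ rewrite range-suc a m with v∈
... | here refl  = here (All.tabulate (proj₁ ∘ ∈-range⁻))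
... | there v∈′ = there (proj₁ (∈-range⁻ v∈′)) (range-cuts (suc a) m v∈′)

cuts⇒≡range : ∀ {xs} a m → xs ↭ range a m → (∀ {v} → v ∈ range a m → Cut v xs) → xs ≡ range a m
cuts⇒≡range a zero xs↭ _ = ↭-empty-inv xs↭
cuts⇒≡range {[]} a (suc m) xs↭ _ = contradiction (trans (↭-length xs↭) (length-range a (suc m))) λ ()
cuts⇒≡range {x ∷ xs} a (suc m) x∷xs↭ cuts
  with refl ← cut-head (cuts (∈-range-suc (here refl))) (proj₁ (∈-range⁻ (∈-resp-↭ x∷xs↭ (here refl)))) =
  trans (cong (a ∷_) (cuts⇒≡range (suc a) m xs↭ tail-cuts)) (sym (range-suc a m))
  where
  xs↭ : xs ↭ range (suc a) m
  xs↭ = drop-∷ (subst (a ∷ xs ↭_) (range-suc a m) x∷xs↭)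
  tail-cuts : ∀ {v} → v ∈ range (suc a) m → Cut v xs
  tail-cuts v∈ = cut-∷⁻ (proj₁ (∈-range⁻ v∈)) (cuts (∈-range-suc (there v∈)))

-- Duplication-loss steps destroy few cuts

CutsOutside : List ℕ → List ℕ → Set
CutsOutside D xs = ∀ {v} → v ∈ xs → v ∉ D → Cut v xs

selected⊆ : ∀ mask xs → selected mask xs ⊆ xs
selected⊆ []             _        ()
selected⊆ (_ ∷ _)        []       ()
selected⊆ (true  ∷ mask) (x ∷ xs) (here x≡)  = here x≡
selected⊆ (true  ∷ mask) (x ∷ xs) (there v∈) = there (selected⊆ mask xs v∈)
selected⊆ (false ∷ mask) (x ∷ xs) v∈         = there (selected⊆ mask xs v∈)

unselected⊆ : ∀ mask xs → unselected mask xs ⊆ xs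
unselected⊆ []             _        ()
unselected⊆ (_ ∷ _)        []       ()
unselected⊆ (true  ∷ mask) (x ∷ xs) v∈         = there (unselected⊆ mask xs v∈)
unselected⊆ (false ∷ mask) (x ∷ xs) (here x≡)  = here x≡
unselected⊆ (false ∷ mask) (x ∷ xs) (there v∈) = there (unselected⊆ mask xs v∈)

cutsOutside-step : ∀ {K π π′ D} → DLStep K π π′ → CutsOutside D π →
  ∃[ F ] length F ≤ K × CutsOutside (F ++ D) π′
cutsOutside-step {D = D} (pre , frag , suf , mask , refl , |frag|≤K , _ , refl) outside =
  frag , |frag|≤K , λ v∈ v∉ → subst (Cut _) (sym regroup)
    (cut-replace pre shuffled⊆frag (v∉ ∘ ∈-++⁺ˡ)
      (outside (Subsetₚ.++⁺ʳ pre (Subsetₚ.++⁺ˡ suf shuffled⊆frag) (subst (_ ∈_) regroup v∈)) (v∉ ∘ ∈-++⁺ʳ frag)))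
  where
  shuffled = selected mask frag ++ unselected mask frag
  shuffled⊆frag : shuffled ⊆ frag
  shuffled⊆frag v∈ = [ selected⊆ mask frag , unselected⊆ mask frag ]′ (∈-++⁻ (selected mask frag) v∈)
  regroup : pre ++ selected mask frag ++ unselected mask frag ++ suf ≡ pre ++ shuffled ++ suf
  regroup = cong (pre ++_) (sym (++-assoc (selected mask frag) _ suf))

cutsOutside-steps : ∀ {K} p {π π′ D} → DLSteps K p π π′ → CutsOutside D π →
  ∃[ D′ ] length D′ ≤ length D + K * p × CutsOutside D′ π′
cutsOutside-steps zero {D = D} refl outside = D , m≤m+n (length D) _ , outside
cutsOutside-steps {K} (suc p) {D = D} (_ , step , steps) outside
  with F , |F|≤K , outside′ ← cutsOutside-step step outside
  with D′ , |D′| , outside″ ← cutsOutside-steps p steps outside′ = D′ , bound , outside″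
  where
  open ≤-Reasoning
  bound : length D′ ≤ length D + K * suc p
  bound = begin
    length D′                     ≤⟨ |D′| ⟩
    length (F ++ D) + K * p       ≡⟨ cong (_+ K * p) (length-++ F) ⟩
    length F + length D + K * p   ≤⟨ +-monoˡ-≤ (K * p) (+-monoˡ-≤ (length D) |F|≤K) ⟩
    K + length D + K * p          ≡⟨ cong (_+ K * p) (+-comm K (length D)) ⟩
    length D + K + K * p          ≡⟨ +-assoc (length D) K (K * p) ⟩
    length D + (K + K * p)        ≡⟨ cong (length D +_) (*-suc K p) ⟨
    length D + K * suc p          ∎

inC⇒cutsOutside : ∀ {K p τ} → InC K p τ → ∃[ D ] length D ≤ K * p × CutsOutside D τ
inC⇒cutsOutside {p = p} (m , steps) = cutsOutside-steps p {D = []} steps (λ v∈ _ → range-cuts 1 m v∈)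

-- Deleting an entry

StrictlyMonotoneOn : (ℕ → Set) → (ℕ → ℕ) → Set
StrictlyMonotoneOn P f = ∀ {x y} → P x → P y → x < y → f x < f y

module _ {P : ℕ → Set} {f : ℕ → ℕ} (mono : StrictlyMonotoneOn P f) where

  reflects-< : ∀ {x y} → P x → P y → f x < f y → x < y
  reflects-< {x} {y} px py fx<fy with <-cmp x y
  ... | tri< x<y _ _ = x<y
  ... | tri≈ _ refl _ = contradiction fx<fy (<-irrefl refl)
  ... | tri> _ _ y<x = contradiction fx<fy (<-asym (mono py px y<x))

  injectiveOn : ∀ {x y} → P x → P y → f x ≡ f y → x ≡ y
  injectiveOn {x} {y} px py fx≡fy with <-cmp x y
  ... | tri< x<y _ _ = contradiction (mono px py x<y) (<-irrefl fx≡fy)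
  ... | tri≈ _ x≡y _ = x≡y
  ... | tri> _ _ y<x = contradiction (mono py px y<x) (<-irrefl (sym fx≡fy))

  orderIso-map : ∀ {xs} → All P xs → OrderIso (map f xs) xs
  orderIso-map []          = []
  orderIso-map (px ∷ pxs) = compare pxs ∷ orderIso-map pxs
    where
    compare : ∀ {ys} → All P ys → Pointwise _ (map f ys) ys
    compare []          = []
    compare (py ∷ pys) =
      (mk⇔ (reflects-< px py) (mono px py) , mk⇔ (reflects-< py px) (mono py px)) ∷ compare pys

  unique-map : ∀ {xs} → All P xs → Unique xs → Unique (map f xs)
  unique-map []          []          = []
  unique-map (px ∷ pxs) (x≢ ∷ uxs) =
    Allₚ.map⁺ (All.zipWith (λ (x≢y , py) fx≡fy → x≢y (injectiveOn px py fx≡fy)) (x≢ , pxs)) ∷ unique-map pxs uxs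

  cut-map⁻ : ∀ {e xs} → All P xs → P e → Cut (f e) (map f xs) → Cut e xs
  cut-map⁻ {e} pxs pe c = go pxs c refl
    where
    go : ∀ {w xs} → All P xs → Cut w (map f xs) → w ≡ f e → Cut e xs
    go (px ∷ pxs) (here fx<) fx≡fe with refl ← injectiveOn px pe fx≡fe =
      here (All.zipWith (λ (px′ , fx<fx′) → reflects-< px px′ fx<fx′) (pxs , Allₚ.map⁻ fx<))
    go (px ∷ pxs) (there fx<fe c) refl = there (reflects-< px pe fx<fe) (go pxs c refl)

-- Renumbers the remaining values after the value c is deleted (shiftDown c c is junk).
shiftDown : ℕ → ℕ → ℕ
shiftDown c y with y <? c
... | yes _ = y
... | no  _ = pred y

shiftUp : ℕ → ℕ → ℕ
shiftUp c y with y <? c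
... | yes _ = y
... | no  _ = suc y

shiftDown-view : ∀ c {y} → c ≢ y → (y < c × shiftDown c y ≡ y) ⊎ (c < y × suc (shiftDown c y) ≡ y)
shiftDown-view c {y} c≢y with y <? c
... | yes y<c = inj₁ (y<c , refl)
... | no  y≮c with ≤∧≢⇒< (≮⇒≥ y≮c) c≢y
...   | c<y@(s≤s _) = inj₂ (c<y , refl)

shiftUp-shiftDown : ∀ c {y} → c ≢ y → shiftUp c (shiftDown c y) ≡ y
shiftUp-shiftDown c {y} c≢y with shiftDown c y | shiftDown-view c c≢y
... | _ | inj₁ (y<c , refl) with y <? c
...   | yes _   = refl
...   | no  y≮c = contradiction y<c y≮c
shiftUp-shiftDown c {y} c≢y | z | inj₂ (c<y , refl) with z <? c
...   | yes z<c = contradiction z<c (≤⇒≯ (≤-pred c<y))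
...   | no  _   = refl

shiftDown-monotone : ∀ c → StrictlyMonotoneOn (c ≢_) (shiftDown c)
shiftDown-monotone c {y} {y′} c≢y c≢y′ y<y′ with shiftDown-view c c≢y | shiftDown-view c c≢y′
... | inj₁ (_ , eq)   | inj₁ (_ , eq′)    = subst₂ _<_ (sym eq) (sym eq′) y<y′
... | inj₁ (y<c , eq) | inj₂ (c<y′ , eq′) =
  subst₂ _<_ (sym eq) refl (<-≤-trans y<c (≤-pred (subst (c <_) (sym eq′) c<y′)))
... | inj₂ (c<y , _)  | inj₁ (y′<c , _)   = contradiction (<-trans y<y′ y′<c) (<-asym c<y)
... | inj₂ (_ , eq)   | inj₂ (_ , eq′)    = ≤-pred (subst₂ _<_ (sym eq) (sym eq′) y<y′)

shiftDown-∈-range : ∀ {c y m} → c ∈ range 1 (suc m) → y ∈ range 1 (suc m) → c ≢ y →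
  shiftDown c y ∈ range 1 m
shiftDown-∈-range {c} {y} c∈ y∈ c≢y with ∈-range⁻ c∈ | ∈-range⁻ y∈ | shiftDown-view c c≢y
... | _ , c<    | 1≤y , _ | inj₁ (y<c , eq) =
  subst (_∈ range 1 _) (sym eq) (∈-range⁺ 1≤y (<-≤-trans y<c (≤-pred c<)))
... | 1≤c , _   | _ , y<  | inj₂ (c<y , eq) =
  ∈-range⁺ (≤-trans 1≤c (≤-pred (subst (c <_) (sym eq) c<y))) (≤-pred (subst (_< _) (sym eq) y<))

StrictPatternsInC : ℕ → ℕ → ℕ → List ℕ → Set
StrictPatternsInC K p n σ = (τ : List ℕ) → IsPerm (length τ) τ → IsPattern τ σ → length τ < n → InC K p τ

standardise-deletion : ∀ {c s} → c ∷ s ↭ range 1 (suc (length s)) →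
  let τ = map (shiftDown c) s in IsPerm (length τ) τ × OrderIso τ s
standardise-deletion {c} {s} cs↭ =
  subst (λ m → map (shiftDown c) s ↭ range 1 m) (sym (length-map (shiftDown c) s)) τ↭ ,
  orderIso-map (shiftDown-monotone c) c≢s
  where
  ucs : Unique (c ∷ s)
  ucs = Unique-resp-↭ (↭-sym cs↭) (range-unique 1 (suc (length s)))
  c≢s : All (c ≢_) s
  c≢s = AllPairs.head ucs
  τ⊆ : All (_∈ range 1 (length s)) (map (shiftDown c) s)
  τ⊆ = Allₚ.map⁺ (All.tabulate λ y∈ →
    shiftDown-∈-range (∈-resp-↭ cs↭ (here refl)) (∈-resp-↭ cs↭ (there y∈)) (All.lookup c≢s y∈))
  τ↭ : map (shiftDown c) s ↭ range 1 (length s)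
  τ↭ = unique-⊆⇒↭ (unique-map (shiftDown-monotone c) c≢s (AllPairs.tail ucs)) (range-unique 1 (length s)) τ⊆
         (≤-reflexive (trans (length-range 1 (length s)) (sym (length-map (shiftDown c) s))))

cutsOutside-deletion : ∀ {K p n} L c R → IsPerm n (L ++ c ∷ R) → StrictPatternsInC K p n (L ++ c ∷ R) →
  ∃[ X ] length X ≤ K * p × CutsOutside X (L ++ R)
cutsOutside-deletion {K} {p} {n} L c R σ↭ strict =
  map (shiftUp c) D , subst (_≤ K * p) (sym (length-map (shiftUp c) D)) |D| , lift
  where
  s = L ++ R
  τ = map (shiftDown c) s
  n≡ : n ≡ suc (length s)
  n≡ = trans (sym (↭range-length σ↭)) (↭-length (shift c L R))
  cs↭ : c ∷ s ↭ range 1 (suc (length s))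
  cs↭ = subst (λ m → c ∷ s ↭ range 1 m) n≡ (↭-trans (↭-sym (shift c L R)) σ↭)
  c≢s : All (c ≢_) s
  c≢s = AllPairs.head (Unique-resp-↭ (↭-sym cs↭) (range-unique 1 (suc (length s))))
  τ-perm : IsPerm (length τ) τ
  τ-perm = proj₁ (standardise-deletion cs↭)
  τ-pattern : IsPattern τ (L ++ c ∷ R)
  τ-pattern =
    s , Sublistₚ.++⁺ (Sublist.⊆-refl {x = L}) (c Sublist.∷ʳ Sublist.⊆-refl) , proj₂ (standardise-deletion cs↭)
  |τ|<n : length τ < n
  |τ|<n = subst₂ _<_ (sym (length-map (shiftDown c) s)) (sym n≡) ≤-refl
  τ-cutsOutside = inC⇒cutsOutside (strict τ τ-perm τ-pattern |τ|<n)
  D = proj₁ τ-cutsOutside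
  |D| = proj₁ (proj₂ τ-cutsOutside)
  τ-cuts = proj₂ (proj₂ τ-cutsOutside)
  lift : CutsOutside (map (shiftUp c) D) s
  lift {e} e∈s e∉X = cut-map⁻ (shiftDown-monotone c) c≢s c≢e (τ-cuts (∈-map⁺ (shiftDown c) e∈s) shifted∉D)
    where
    c≢e = All.lookup c≢s e∈s
    shifted∉D : shiftDown c e ∉ D
    shifted∉D d∈ = e∉X (subst (_∈ map (shiftUp c) D) (shiftUp-shiftDown c c≢e) (∈-map⁺ (shiftUp c) d∈))

-- Permutations whose strict patterns all lie in C(K,p)

cut-between : ∀ {c d mid X₁ X₂} → Unique (c ∷ mid ∷ʳ d) →
  CutsOutside X₁ (mid ∷ʳ d) → CutsOutside X₂ ((c ∷ mid) ++ []) → length (X₁ ++ X₂) < length mid →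
  ∃[ v ] Cut v (c ∷ mid ∷ʳ d)
cut-between {c} {d} {mid} {X₁} ucs outside₁ outside₂ long
  with e , e∈mid , e∉X ← ∃∉-of-longer (proj₁ (Unique-++⁻ mid (AllPairs.tail ucs))) long =
  e , there (cut-∷⇒< (All.lookup (Allₚ.++⁻ˡ mid (AllPairs.head ucs)) e∈mid) cut₂) cut₁
  where
  cut₁ : Cut e (mid ∷ʳ d)
  cut₁ = outside₁ (∈-++⁺ˡ e∈mid) (e∉X ∘ ∈-++⁺ˡ)
  cut₂ : Cut e (c ∷ mid)
  cut₂ = cut-++ˡ (c ∷ mid) (there e∈mid) (outside₂ (∈-++⁺ˡ (there e∈mid)) (e∉X ∘ ∈-++⁺ʳ X₁))

∃-cut : ∀ {K p n} σ → IsPerm n σ → StrictPatternsInC K p n σ → K * p + K * p + 2 < n → ∃[ v ] Cut v σ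
∃-cut []       σ↭ _ big = contradiction (subst (2 <_) (sym (↭range-length σ↭)) (≤-<-trans (m≤n+m 2 _) big)) λ ()
∃-cut (c ∷ cs) σ↭ strict big with initLast cs
... | [] = contradiction (subst (2 <_) (sym (↭range-length σ↭)) (≤-<-trans (m≤n+m 2 _) big)) λ { (s≤s ()) }
... | mid ∷ʳ′ d = cut-between (Unique-resp-↭ (↭-sym σ↭) (range-unique 1 _)) outside₁ outside₂ long
  where
  deletion₁ = cutsOutside-deletion [] c (mid ∷ʳ d) σ↭ strict
  deletion₂ = cutsOutside-deletion (c ∷ mid) d [] σ↭ strict
  X₁ = proj₁ deletion₁
  X₂ = proj₁ deletion₂
  outside₁ = proj₂ (proj₂ deletion₁)
  outside₂ = proj₂ (proj₂ deletion₂)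
  n≡ : _ ≡ length mid + 2
  n≡ = trans (sym (↭range-length σ↭)) (trans (cong suc (length-++ mid)) (sym (+-suc (length mid) 1)))
  long : length (X₁ ++ X₂) < length mid
  long = ≤-<-trans
    (subst (_≤ _) (sym (length-++ X₁)) (+-mono-≤ (proj₁ (proj₂ deletion₁)) (proj₁ (proj₂ deletion₂))))
    (+-cancelʳ-< 2 _ (length mid) (subst (_ <_) n≡ big))

cutsOutside-insert : ∀ {X v} L {R} → All (_< v) L → All (v <_) R →
  CutsOutside X (L ++ R) → CutsOutside X (L ++ v ∷ R)
cutsOutside-insert {v = v} L {R} L<v v<R outside e∈ e∉X with ∈-resp-↭ (shift v L R) e∈
... | here refl    = cut-++⁺ L L<v (here v<R)
... | there e∈L++R = cut-insert L L<v v<R (outside e∈L++R e∉X)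

cutsOutside-around-cut : ∀ {K p n v σ} → Cut v σ → IsPerm n σ → StrictPatternsInC K p n σ →
  ∃[ X ] length X ≤ K * p × CutsOutside X σ
cutsOutside-around-cut v-cut σ↭ strict with cut⇒++ v-cut
... | L , R , refl , L<v , v<R =
  Product.map₂ (Product.map₂ (cutsOutside-insert L L<v v<R)) (cutsOutside-deletion L _ R σ↭ strict)

cutsOutside-strict : ∀ {K p n σ} → IsPerm n σ → StrictPatternsInC K p n σ → K * p + K * p + 2 < n →
  ∃[ X ] length X ≤ K * p × CutsOutside X σ
cutsOutside-strict σ↭ strict big = cutsOutside-around-cut (proj₂ (∃-cut _ σ↭ strict big)) σ↭ strict

-- Blocks of consecutive values

block : ℕ → ℕ → List ℕ
block B b = range (suc (b * B)) B

blocks-disjoint : ∀ B {b b′ x} → b < b′ → x ∈ block B b → x ∈ block B b′ → ⊥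
blocks-disjoint B {b} {b′} {x} b<b′ x∈ x∈′ = <-irrefl refl (begin-strict
  b′ * B     <⟨ proj₁ (∈-range⁻ x∈′) ⟩
  x          ≤⟨ ≤-pred (proj₂ (∈-range⁻ x∈)) ⟩
  b * B + B  ≡⟨ +-comm (b * B) B ⟩
  suc b * B  ≤⟨ *-monoˡ-≤ B b<b′ ⟩
  b′ * B     ∎)
  where open ≤-Reasoning

∃-gap : ∀ B (X : List ℕ) → length X < B →
  ∃[ i ] (∀ {j} → j ∈ range i B → j ∈ range 1 (B * B) × j ∉ X)
∃-gap B X |X|<B with Finₚ.any? (λ b → ¬? (Any.any? (_∈? block B (toℕ b)) X))
... | yes (b , missed) = suc (toℕ b * B) , λ j∈ → inside j∈ , λ j∈X → missed (lose j∈X j∈)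
  where
  inside : ∀ {j} → j ∈ block B (toℕ b) → j ∈ range 1 (B * B)
  inside j∈ = ∈-range⁺ (≤-trans (s≤s z≤n) (proj₁ (∈-range⁻ j∈))) (<-≤-trans (proj₂ (∈-range⁻ j∈))
    (s≤s (≤-trans (≤-reflexive (+-comm (toℕ b * B) B)) (*-monoˡ-≤ B (Finₚ.toℕ<n b)))))
... | no none = ⊥-elim (blocks-disjoint B b<b′ (lookup-index (hit b))
                          (subst (λ k → lookup X k ∈ block B (toℕ b′)) (sym same) (lookup-index (hit b′))))
  where
  hit : ∀ b → Any (_∈ block B (toℕ b)) X
  hit b = decidable-stable (Any.any? (_∈? block B (toℕ b)) X) (λ missed → none (b , missed))
  collision = Finₚ.pigeonhole |X|<B (λ b → index (hit b))
  b = proj₁ collision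
  b′ = proj₁ (proj₂ collision)
  b<b′ = proj₁ (proj₂ (proj₂ collision))
  same = proj₂ (proj₂ (proj₂ collision))

run⇒prefix : ∀ {W} i N k → W ↭ range i ((N + 1) + k) → (∀ {v} → v ∈ range i (N + 1) → Cut v W) →
  ∃[ J ] W ≡ range i (N + 1) ++ J × J ↭ range (i + (N + 1)) k
run⇒prefix i N k W↭ cuts with cut⇒++ (cuts (∈-range-last i N))
... | L , J , refl , L<w , w<J = J , trans (sym (++-assoc L [ i + N ] J)) (cong (_++ J) M≡) , proj₂ split
  where
  w+1 : i + N + 1 ≡ i + (N + 1)
  w+1 = +-assoc i N 1
  M↭ : (L ++ [ i + N ]) ++ J ↭ range i ((N + 1) + k)
  M↭ = subst (_↭ _) (sym (++-assoc L [ i + N ] J)) W↭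
  M< : All (_< i + (N + 1)) (L ++ [ i + N ])
  M< = All.map (λ {x} x≤w → subst (x <_) w+1 (≤-<-trans x≤w (m<m+n (i + N) (s≤s z≤n))))
               (Allₚ.++⁺ (All.map <⇒≤ L<w) (≤-refl ∷ []))
  J≥ : All (i + (N + 1) ≤_) J
  J≥ = All.map (λ {x} w<x → subst (_≤ x) (trans (+-comm 1 (i + N)) w+1) w<x) w<J
  split = ↭range-split i (N + 1) k M↭ M< J≥
  M≡ : L ++ [ i + N ] ≡ range i (N + 1)
  M≡ = cuts⇒≡range i (N + 1) (proj₁ split) λ v∈ →
    cut-++ˡ (L ++ [ i + N ]) (∈-resp-↭ (↭-sym (proj₁ split)) v∈)
      (subst (Cut _) (sym (++-assoc L [ i + N ] J)) (cuts v∈))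

∸-regroup : ∀ a N n → suc a + N ≤ n → n ∸ a ≡ (N + 1) + (n ∸ (suc a + N))
∸-regroup a N n i+N≤n = begin
  n ∸ a                  ≡⟨ cong (_∸ a) (m+[n∸m]≡n i+N≤n) ⟨
  suc a + N + r ∸ a      ≡⟨ cong (_∸ a) regroup ⟩
  a + ((N + 1) + r) ∸ a  ≡⟨ m+n∸m≡n a _ ⟩
  (N + 1) + r            ∎
  where
  open ≡-Reasoning
  open +-*-Solver
  r = n ∸ (suc a + N)
  regroup : suc a + N + r ≡ a + ((N + 1) + r)
  regroup = solve 3 (λ a N r → con 1 :+ a :+ N :+ r := a :+ ((N :+ con 1) :+ r)) refl a N r

cuts⇒block : ∀ {n σ} i N → σ ↭ range 1 n → (∀ {v} → v ∈ range i (N + 1) → Cut v σ) →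
  ∃₂ λ I J → σ ≡ I ++ range i (N + 1) ++ J × I ↭ range 1 (i ∸ 1) × J ↭ range (i + N + 1) (n ∸ (i + N))
cuts⇒block zero N σ↭ cuts =
  contradiction (proj₁ (∈-range⁻ (∈-resp-↭ σ↭ (cut⇒∈ (cuts (∈-range-first 0 N)))))) λ ()
cuts⇒block {n} (suc a) N σ↭ cuts with cut⇒++ (cuts (∈-range-first (suc a) N))
... | I , W′ , refl , I<i , i<W′ =
  I , J , cong (I ++_) (proj₁ (proj₂ prefix)) , proj₁ split ,
  subst (λ b → J ↭ range b (n ∸ (suc a + N))) (sym (+-assoc (suc a) N 1)) (proj₂ (proj₂ prefix))
  where
  w≤n : suc a + N ≤ n
  w≤n = ≤-pred (proj₂ (∈-range⁻ (∈-resp-↭ σ↭ (cut⇒∈ (cuts (∈-range-last (suc a) N))))))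
  σ↭′ : I ++ suc a ∷ W′ ↭ range 1 (a + (n ∸ a))
  σ↭′ = subst (λ m → I ++ suc a ∷ W′ ↭ range 1 m)
              (sym (m+[n∸m]≡n (≤-trans (n≤1+n a) (≤-trans (m≤m+n (suc a) N) w≤n)))) σ↭
  split = ↭range-split 1 a (n ∸ a) σ↭′ I<i (≤-refl ∷ All.map <⇒≤ i<W′)
  W↭ : suc a ∷ W′ ↭ range (suc a) ((N + 1) + (n ∸ (suc a + N)))
  W↭ = subst (λ m → suc a ∷ W′ ↭ range (suc a) m) (∸-regroup a N n w≤n) (proj₂ split)
  W-cuts : ∀ {v} → v ∈ range (suc a) (N + 1) → Cut v (suc a ∷ W′)
  W-cuts v∈ = proj₂ (cut-++⁻ I (All-<⇒∉ (All.map (λ x<i → <-≤-trans x<i (proj₁ (∈-range⁻ v∈))) I<i)) (cuts v∈))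
  prefix = run⇒prefix (suc a) N (n ∸ (suc a + N)) W↭ W-cuts
  J = proj₁ prefix

square-bound : ∀ N n → (N + 2) ^ 2 ∸ 2 < n → N + N + 2 < n × (N + 1) * (N + 1) ≤ n
square-bound N n big =
  ≤-<-trans (m≤m+n (N + N + 2) _) (subst (_< n) e₁ big) ,
  ≤-trans (m≤m+n ((N + 1) * (N + 1)) _) (<⇒≤ (subst (_< n) e₂ big))
  where
  open +-*-Solver
  e₁ : (N + 2) ^ 2 ∸ 2 ≡ (N + N + 2) + (N * N + N + N)
  e₁ = trans (cong (_∸ 2) (solve 1 (λ N →
         (N :+ con 2) :^ 2 := con 2 :+ ((N :+ N :+ con 2) :+ (N :* N :+ N :+ N))) refl N)) (m+n∸m≡n 2 _)
  e₂ : (N + 2) ^ 2 ∸ 2 ≡ (N + 1) * (N + 1) + (N + N + 1)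
  e₂ = trans (cong (_∸ 2) (solve 1 (λ N →
         (N :+ con 2) :^ 2 := con 2 :+ ((N :+ con 1) :* (N :+ con 1) :+ (N :+ N :+ con 1))) refl N)) (m+n∸m≡n 2 _)

lemma4 : (K p n : ℕ) → 2 ≤ K → 1 ≤ p → (σ : List ℕ) → IsPerm n σ →
    ¬ InC K p σ → (K * p + 2) ^ 2 ∸ 2 < n →
    ((τ : List ℕ) → IsPerm (length τ) τ → IsPattern τ σ → length τ < n → InC K p τ) →
    Σ ℕ λ i → Σ (List ℕ) λ I → Σ (List ℕ) λ J →
    (1 ≤ i) ×
    (σ ≡ I ++ map (i +_) (upTo (K * p + 1)) ++ J) ×
    (I ↭ idPerm (i ∸ 1)) ×
    (J ↭ map (λ t → i + K * p + 1 + t) (upTo (n ∸ (i + K * p))))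
lemma4 K p n _ _ σ σ↭ _ big strict
  with few , square ← square-bound (K * p) n big
  with X , |X| , outside ← cutsOutside-strict σ↭ strict few
  with i , gap ← ∃-gap (K * p + 1) X (≤-<-trans |X| (m<m+n (K * p) (s≤s z≤n)))
  with I , J , σ≡ , I↭ , J↭ ← cuts⇒block i (K * p) σ↭ (λ v∈ →
         outside (∈-resp-↭ (↭-sym σ↭) (range-⊆ square (proj₁ (gap v∈)))) (proj₂ (gap v∈))) =
  i , I , J , proj₁ (∈-range⁻ (proj₁ (gap (∈-range-first i (K * p))))) , σ≡ , I↭ , J↭
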